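{- In the CONGEST model, a $3$-ruling edge set $R$ of a graph $G$ can be transformed into a $2$-ruling edge set $S$ of $G$ with $R\subseteq S$ in $O(1)$ rounds.
   Context: CONGEST model: the network is an $n$-node graph $G=(V,E)$; each node has a unique $O(\log n)$-bit ID; in each synchronous round every node may send a message of $O(\log n)$ bits to each neighbor and perform unbounded local computation. The distance between two edges is their distance in the line graph of $G$. A $\beta$-ruling edge set is a set $R\subseteq E$ such that any two distinct edges of $R$ are at distance at least $2$ (share no endpoint) and every edge of $G$ is at distance at most $\beta$ from some edge of $R$. -}

module Defs where

open import Data.Nat using (ℕ; zero; suc; _<_; _^_)
open import Data.Fin using (Fin)
open import Data.Fin.Properties using (_≟_)
open import Data.Bool using (Bool; true; false; _∧_)
open import Data.List using (List; []; _∷_; map; filterᵇ; allFin)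
open import Data.Product using (Σ; _×_; _,_; proj₁; proj₂; ∃)
open import Data.Sum using (_⊎_)
open import Relation.Binary.PropositionalEquality using (_≡_)
open import Relation.Nullary using (¬_; does)
open import Function.Definitions using (Injective)

record Graph (n : ℕ) : Set where
  field
    adj    : Fin n → Fin n → Bool
    sym    : ∀ u v → adj u v ≡ adj v u
    irrefl : ∀ v → adj v v ≡ false
open Graph public

-- An edge {u,v}, presented by an ordered pair of adjacent vertices.
Edge : ∀ {n} → Graph n → Set
Edge {n} G = Σ (Fin n × Fin n) λ p → adj G (proj₁ p) (proj₂ p) ≡ true

ends₁ ends₂ : ∀ {n} {G : Graph n} → Edge G → Fin n
ends₁ e = proj₁ (proj₁ e)
ends₂ e = proj₂ (proj₁ e)

SameEdge : ∀ {n} {G : Graph n} → Edge G → Edge G → Set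
SameEdge {G = G} e f = (ends₁ {G = G} e ≡ ends₁ {G = G} f × ends₂ {G = G} e ≡ ends₂ {G = G} f)
             ⊎ (ends₁ {G = G} e ≡ ends₂ {G = G} f × ends₂ {G = G} e ≡ ends₁ {G = G} f)

Share : ∀ {n} {G : Graph n} → Edge G → Edge G → Set
Share {G = G} e f = (ends₁ {G = G} e ≡ ends₁ {G = G} f ⊎ ends₁ {G = G} e ≡ ends₂ {G = G} f)
          ⊎ (ends₂ {G = G} e ≡ ends₁ {G = G} f ⊎ ends₂ {G = G} e ≡ ends₂ {G = G} f)

-- Dist≤ k e f : distance between e and f in the line graph of G is ≤ k.
data Dist≤ {n} {G : Graph n} : ℕ → Edge G → Edge G → Set where
  here : ∀ {k e f} → SameEdge {G = G} e f → Dist≤ k e f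
  step : ∀ {k} {e g f : Edge G} → Share {G = G} e g → Dist≤ {G = G} k g f → Dist≤ (suc k) e f

-- Edge sets: symmetric Boolean membership on vertex pairs
-- (only its values on edges of G are relevant).
record EdgeSet {n} (G : Graph n) : Set where
  field
    mem    : Fin n → Fin n → Bool
    memSym : ∀ u v → mem u v ≡ mem v u
open EdgeSet public

_∈E_ : ∀ {n} {G : Graph n} → Edge G → EdgeSet G → Set
_∈E_ {G = G} e R = mem R (ends₁ {G = G} e) (ends₂ {G = G} e) ≡ true

_⊆E_ : ∀ {n} {G : Graph n} → EdgeSet G → EdgeSet G → Set
_⊆E_ {G = G} R S = ∀ (e : Edge G) → e ∈E R → e ∈E S

IsRuling : ∀ {n} (G : Graph n) → ℕ → EdgeSet G → Set
IsRuling G β R =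
    (∀ (e f : Edge G) → e ∈E R → f ∈E R → ¬ SameEdge {G = G} e f → ¬ Share {G = G} e f)
  × (∀ (e : Edge G) → ∃ λ (f : Edge G) → f ∈E R × Dist≤ {G = G} β e f)

-- The CONGEST model.
-- Ports of v: its neighbours listed in increasing index order
-- (this is an arbitrary port numbering, since graphs are arbitrary).

nbrs : ∀ {n} → Graph n → Fin n → List (Fin n)
nbrs {n} G v = filterᵇ (adj G v) (allFin n)

indexOf : ∀ {n} → Fin n → List (Fin n) → ℕ
indexOf x [] = zero
indexOf x (y ∷ ys) with does (x ≟ y)
... | true  = zero
... | false = suc (indexOf x ys)

portOf : ∀ {n} → Graph n → Fin n → Fin n → ℕ
portOf G v u = indexOf u (nbrs G v)

-- A CONGEST algorithm with messages of at most B·log(n+1) bits,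
-- i.e. messages are elements of Fin ((n+1)^B), B a constant.
-- Local state and local computation are unrestricted.
record Algorithm : Set₁ where
  field
    B     : ℕ
    State : ℕ → Set
    -- initial state from: n, own ID, input bit (membership in R) per port
    init  : (n : ℕ) → ℕ → List Bool → State n
    -- message sent in a round on a given port
    send  : ∀ {n} → State n → ℕ → Fin (suc n ^ B)
    -- state update from the messages received, listed per port
    recv  : ∀ {n} → State n → List (Fin (suc n ^ B)) → State n
    -- output bit per port (membership of that edge in S)
    out   : ∀ {n} → State n → ℕ → Bool
open Algorithm public

stateAt : (A : Algorithm) → ∀ {n} (G : Graph n) → (Fin n → ℕ) → EdgeSet G
        → ℕ → Fin n → State A n
stateAt A {n} G ID R zero v =
  init A n (ID v) (map (mem R v) (nbrs G v))
stateAt A G ID R (suc t) v =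
  recv A (stateAt A G ID R t v)
    (map (λ u → send A (stateAt A G ID R t u) (portOf G u v)) (nbrs G v))

outBit : (A : Algorithm) → ∀ {n} (G : Graph n) → (Fin n → ℕ) → EdgeSet G
       → ℕ → Fin n → Fin n → Bool
outBit A G ID R T u v = out A (stateAt A G ID R T u) (portOf G u v)

Consistent : (A : Algorithm) → ∀ {n} (G : Graph n) → (Fin n → ℕ) → EdgeSet G
           → ℕ → Set
Consistent A {n} G ID R T =
  ∀ (u v : Fin n) → adj G u v ≡ true → outBit A G ID R T u v ≡ outBit A G ID R T v u

outputSet : (A : Algorithm) → ∀ {n} (G : Graph n) → (ID : Fin n → ℕ) → (R : EdgeSet G)
          → (T : ℕ) → Consistent A G ID R T → EdgeSet G
outputSet A G ID R T cons = record
  { mem    = λ u v → adj G u v ∧ outBit A G ID R T u v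
  ; memSym = λ u v → symProof u v }
  where
    symProof : ∀ u v → (adj G u v ∧ outBit A G ID R T u v) ≡ (adj G v u ∧ outBit A G ID R T v u)
    symProof u v with adj G u v | adj G v u | sym G u v | cons u v
    ... | false | .false | Relation.Binary.PropositionalEquality.refl | _ = Relation.Binary.PropositionalEquality.refl
    ... | true  | .true  | Relation.Binary.PropositionalEquality.refl | c
        rewrite c Relation.Binary.PropositionalEquality.refl = Relation.Binary.PropositionalEquality.refl

-- Valid ID assignments: unique IDs of O(log n) bits, i.e. in [0, (n+1)^c).
ValidIDs : (c n : ℕ) → (Fin n → ℕ) → Set
ValidIDs c n ID = Injective _≡_ _≡_ ID × (∀ v → ID v < suc n ^ c)

-- Call a vertex covered if it is an endpoint of an edge of R, near if it is
-- uncovered with a covered neighbour, and far otherwise.  Every far vertex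
-- proposes to its first near neighbour, every near vertex accepts its first
-- proposer, and S is R together with the accepted edges.  An accepted edge
-- joins a near and a far vertex, neither covered, and no vertex lies on two
-- accepted edges, so S is still a matching.  An edge at distance at most 3
-- from R has an endpoint z within vertex distance 2 of a covered vertex: if
-- z is covered or near, an R-edge is within distance 2; otherwise z is far
-- with a near neighbour, so z proposes to some w, w accepts some x, and the
-- path e, zw, wx reaches the accepted edge wx.  The four bits each node
-- needs (covered, near, proposal, acceptance) take one round each.
module Submission where

open import Defs hiding (sym)
open import Data.Nat using (ℕ; zero; suc; pred; _^_)
open import Data.Fin using (Fin)
open import Data.Fin.Properties using (_≟_)
open import Data.Bool using (Bool; true; false; _∧_; _∨_; not; T?)
open import Data.Bool.Properties
  using (T-≡; not-injective; not-¬; ∧-conicalˡ; ∧-conicalʳ; ∨-conicalˡ; ∨-conicalʳ; ∨-comm; ∨-zeroʳ)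
open import Data.Bool.ListAction using (or; any)
open import Data.Empty using (⊥; ⊥-elim)
open import Data.Product using (Σ; _×_; _,_; proj₂; ∃)
open import Data.Sum using (_⊎_; inj₁; inj₂)
open import Data.List using (List; []; _∷_; map; allFin)
open import Data.List.Properties using (map-cong)
open import Data.List.Relation.Unary.Any using (here; there)
open import Data.List.Relation.Unary.Any.Properties using (any⁺; any⁻)
open import Data.List.Membership.Propositional using (_∈_; find; lose)
open import Data.List.Membership.Propositional.Properties using (∈-filter⁺; ∈-filter⁻; ∈-allFin)
open import Function.Bundles using (Equivalence)
open import Relation.Binary.PropositionalEquality
open import Relation.Nullary using (¬_; yes; no)

∨-true⁻ : ∀ a {b} → a ∨ b ≡ true → a ≡ true ⊎ b ≡ true
∨-true⁻ true  _ = inj₁ refl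
∨-true⁻ false h = inj₂ h

module _ {a} {A : Set a} (p : A → Bool) where

  any-true⁺ : ∀ {x xs} → x ∈ xs → p x ≡ true → any p xs ≡ true
  any-true⁺ x∈xs px = Equivalence.to T-≡ (any⁺ p (lose x∈xs (Equivalence.from T-≡ px)))

  any-true⁻ : ∀ {xs} → any p xs ≡ true → ∃ λ x → x ∈ xs × p x ≡ true
  any-true⁻ {xs} h with find (any⁻ p xs (Equivalence.from T-≡ h))
  ... | x , x∈xs , px = x , x∈xs , Equivalence.to T-≡ px

bitAt : List Bool → ℕ → Bool
bitAt []       _       = false
bitAt (b ∷ _)  zero    = b
bitAt (_ ∷ bs) (suc p) = bitAt bs p

firstTrueAt : List Bool → ℕ → Bool
firstTrueAt []       _       = false
firstTrueAt (b ∷ _)  zero    = b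
firstTrueAt (b ∷ bs) (suc p) = not b ∧ firstTrueAt bs p

firstTrueAt⇒bitAt : ∀ bs p → firstTrueAt bs p ≡ true → bitAt bs p ≡ true
firstTrueAt⇒bitAt (_ ∷ _)  zero    h = h
firstTrueAt⇒bitAt (_ ∷ bs) (suc p) h = firstTrueAt⇒bitAt bs p (∧-conicalʳ _ _ h)

firstTrueAt-unique : ∀ bs p q → firstTrueAt bs p ≡ true → firstTrueAt bs q ≡ true → p ≡ q
firstTrueAt-unique (_ ∷ _)      zero    zero    _  _  = refl
firstTrueAt-unique (true ∷ _)   zero    (suc _) _  ()
firstTrueAt-unique (true ∷ _)   (suc _) _       () _
firstTrueAt-unique (false ∷ _)  zero    _       () _
firstTrueAt-unique (false ∷ _)  (suc _) zero    _  ()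
firstTrueAt-unique (false ∷ bs) (suc p) (suc q) hp hq = cong suc (firstTrueAt-unique bs p q hp hq)

module _ {n : ℕ} where

  indexOf-head : ∀ (x : Fin n) xs → indexOf x (x ∷ xs) ≡ 0
  indexOf-head x xs with x ≟ x
  ... | yes _  = refl
  ... | no x≢x = ⊥-elim (x≢x refl)

  indexOf-tail : ∀ {x y : Fin n} xs → ¬ x ≡ y → indexOf x (y ∷ xs) ≡ suc (indexOf x xs)
  indexOf-tail {x} {y} xs x≢y with x ≟ y
  ... | yes x≡y = ⊥-elim (x≢y x≡y)
  ... | no _    = refl

  indexOf-injective : ∀ {x y : Fin n} xs → x ∈ xs → y ∈ xs → indexOf x xs ≡ indexOf y xs → x ≡ y
  indexOf-injective {x} {y} (z ∷ zs) x∈ y∈ eq with x ≟ z | y ≟ z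
  ... | yes refl | yes refl = refl
  indexOf-injective (z ∷ zs) (here refl) _           _  | no x≢z | no _   = ⊥-elim (x≢z refl)
  indexOf-injective (z ∷ zs) (there _)   (here refl) _  | no _   | no y≢z = ⊥-elim (y≢z refl)
  indexOf-injective (z ∷ zs) (there x∈)  (there y∈)  eq | no _   | no _   =
    indexOf-injective zs x∈ y∈ (cong pred eq)

  bitAt-map-indexOf : ∀ (f : Fin n → Bool) {x} xs → x ∈ xs → bitAt (map f xs) (indexOf x xs) ≡ f x
  bitAt-map-indexOf f {x} (y ∷ ys) x∈ with x ≟ y
  ... | yes refl = refl
  bitAt-map-indexOf f (y ∷ ys) (here refl) | no x≢y = ⊥-elim (x≢y refl)
  bitAt-map-indexOf f (y ∷ ys) (there x∈)  | no _   = bitAt-map-indexOf f ys x∈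

  firstTrueAt-map-holds : ∀ (f : Fin n → Bool) {x xs} → x ∈ xs →
                          firstTrueAt (map f xs) (indexOf x xs) ≡ true → f x ≡ true
  firstTrueAt-map-holds f {x} {xs} x∈ h =
    trans (sym (bitAt-map-indexOf f xs x∈)) (firstTrueAt⇒bitAt (map f xs) (indexOf x xs) h)

  firstTrueAt-map-unique : ∀ (f : Fin n → Bool) {x y xs} → x ∈ xs → y ∈ xs →
                           firstTrueAt (map f xs) (indexOf x xs) ≡ true →
                           firstTrueAt (map f xs) (indexOf y xs) ≡ true → x ≡ y
  firstTrueAt-map-unique f {xs = xs} x∈ y∈ hx hy =
    indexOf-injective xs x∈ y∈ (firstTrueAt-unique (map f xs) _ _ hx hy)

  firstTrueAt-exists : ∀ (f : Fin n → Bool) {x} xs → x ∈ xs → f x ≡ true →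
                       ∃ λ y → y ∈ xs × firstTrueAt (map f xs) (indexOf y xs) ≡ true
  firstTrueAt-exists f (z ∷ zs) x∈ fx with f z in fz
  ... | true =
    z , here refl , subst (λ p → firstTrueAt (true ∷ map f zs) p ≡ true) (sym (indexOf-head z zs)) refl
  firstTrueAt-exists f (z ∷ zs) (here refl) fx | false = ⊥-elim (not-¬ fx fz)
  firstTrueAt-exists f (z ∷ zs) (there x∈)  fx | false with firstTrueAt-exists f zs x∈ fx
  ... | y , y∈ , first with y ≟ z
  ... | yes refl = ⊥-elim (not-¬ (firstTrueAt-map-holds f y∈ first) fz)
  ... | no y≢z   =
    y , there y∈ , subst (λ p → firstTrueAt (false ∷ map f zs) p ≡ true) (sym (indexOf-tail zs y≢z)) first

module GraphProperties {n : ℕ} (G : Graph n) where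

  adj-sym : ∀ {u v} → adj G u v ≡ true → adj G v u ≡ true
  adj-sym {u} {v} = trans (Graph.sym G v u)

  adj⇒∈nbrs : ∀ {u v} → adj G u v ≡ true → v ∈ nbrs G u
  adj⇒∈nbrs {u} {v} h = ∈-filter⁺ (λ x → T? (adj G u x)) (∈-allFin v) (Equivalence.from T-≡ h)

  ∈nbrs⇒adj : ∀ {u v} → v ∈ nbrs G u → adj G u v ≡ true
  ∈nbrs⇒adj {u} v∈ = Equivalence.to T-≡ (proj₂ (∈-filter⁻ (λ x → T? (adj G u x)) {xs = allFin n} v∈))

  ∈-flip : ∀ (S : EdgeSet G) {u v} → mem S u v ≡ true → mem S v u ≡ true
  ∈-flip S {u} {v} = trans (memSym S v u)

  EndOf : Fin n → Edge G → Set
  EndOf z e = z ≡ ends₁ {G = G} e ⊎ z ≡ ends₂ {G = G} e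

  share⇒commonEnd : ∀ {e f} → Share {G = G} e f → ∃ λ z → EndOf z e × EndOf z f
  share⇒commonEnd (inj₁ (inj₁ q)) = _ , inj₁ refl , inj₁ q
  share⇒commonEnd (inj₁ (inj₂ q)) = _ , inj₁ refl , inj₂ q
  share⇒commonEnd (inj₂ (inj₁ q)) = _ , inj₂ refl , inj₁ q
  share⇒commonEnd (inj₂ (inj₂ q)) = _ , inj₂ refl , inj₂ q

  sameEdge-endOf : ∀ {z e f} → SameEdge {G = G} e f → EndOf z e → EndOf z f
  sameEdge-endOf (inj₁ (p , _)) (inj₁ q) = inj₁ (trans q p)
  sameEdge-endOf (inj₁ (_ , p)) (inj₂ q) = inj₂ (trans q p)
  sameEdge-endOf (inj₂ (p , _)) (inj₁ q) = inj₂ (trans q p)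
  sameEdge-endOf (inj₂ (_ , p)) (inj₂ q) = inj₁ (trans q p)

  endOf-equal-or-adjacent : ∀ {z y e} → EndOf z e → EndOf y e → z ≡ y ⊎ adj G z y ≡ true
  endOf-equal-or-adjacent {e = (_ , p)} (inj₁ refl) (inj₁ refl) = inj₁ refl
  endOf-equal-or-adjacent {e = (_ , p)} (inj₁ refl) (inj₂ refl) = inj₂ p
  endOf-equal-or-adjacent {e = (_ , p)} (inj₂ refl) (inj₁ refl) = inj₂ (adj-sym p)
  endOf-equal-or-adjacent {e = (_ , p)} (inj₂ refl) (inj₂ refl) = inj₁ refl

  share-at : ∀ {z w e} → EndOf z e → (p : adj G z w ≡ true) → Share {G = G} e ((z , w) , p)
  share-at (inj₁ q) _ = inj₁ (inj₁ (sym q))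
  share-at (inj₂ q) _ = inj₂ (inj₁ (sym q))

  dist≤2-incident : ∀ {z w e} → EndOf z e → (p : adj G z w ≡ true) → Dist≤ {G = G} 2 e ((z , w) , p)
  dist≤2-incident {z} {w} {e} ze p =
    step {g = (z , w) , p} (share-at {e = e} ze p) (here (inj₁ (refl , refl)))

  dist≤2-twoHops : ∀ {z w x e} → EndOf z e → (p : adj G z w ≡ true) (q : adj G w x ≡ true) →
                   Dist≤ {G = G} 2 e ((w , x) , q)
  dist≤2-twoHops {z} {w} {x} {e} ze p q =
    step {g = (z , w) , p} (share-at {e = e} ze p)
      (step {g = (w , x) , q} (inj₂ (inj₁ refl)) (here (inj₁ (refl , refl))))

  data Reaches (P : Fin n → Set) : ℕ → Fin n → Set where
    done : ∀ {k z} → P z → Reaches P k z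
    hop  : ∀ {k z y} → adj G z y ≡ true → Reaches P k y → Reaches P (suc k) z

  reaches-suc : ∀ {P k z} → Reaches P k z → Reaches P (suc k) z
  reaches-suc (done pz)  = done pz
  reaches-suc (hop zy r) = hop zy (reaches-suc r)

  -- Along a chain of edges, consecutive shared vertices are equal or adjacent, so
  -- edge distance k + 1 from f gives vertex distance k from an endpoint of f.
  dist⇒reaches : ∀ {P : Fin n → Set} {k e f} → (∀ {v} → EndOf v f → P v) →
                 Dist≤ {G = G} (suc k) e f → ∃ λ z → EndOf z e × Reaches P k z
  dist⇒reaches {e = e} {f} endsP (here s) =
    _ , inj₁ refl , done (endsP (sameEdge-endOf {e = e} {f} s (inj₁ refl)))
  dist⇒reaches {e = e} {f} endsP (step {g = g} sh (here s)) with share⇒commonEnd {e} {g} sh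
  ... | z , ze , zg = z , ze , done (endsP (sameEdge-endOf {e = g} {f} s zg))
  dist⇒reaches {e = e} endsP (step {g = g} sh d@(step _ _))
    with dist⇒reaches endsP d | share⇒commonEnd {e} {g} sh
  ... | y , yg , r | z , ze , zg with endOf-equal-or-adjacent {e = g} zg yg
  ... | inj₁ refl = z , ze , reaches-suc r
  ... | inj₂ zy   = z , ze , hop zy r

  Separated : EdgeSet G → Set
  Separated S = ∀ (e f : Edge G) → e ∈E S → f ∈E S → ¬ SameEdge {G = G} e f → ¬ Share {G = G} e f

  IsMatching : EdgeSet G → Set
  IsMatching S = ∀ {z o o′} → adj G z o ≡ true → adj G z o′ ≡ true →
                 mem S z o ≡ true → mem S z o′ ≡ true → o ≡ o′

  matching⇒separated : ∀ {S} → IsMatching S → Separated S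
  matching⇒separated matchingS ((_ , _) , pe) ((_ , _) , pf) eS fS e≢f (inj₁ (inj₁ refl)) =
    e≢f (inj₁ (refl , matchingS pe pf eS fS))
  matching⇒separated {S} matchingS ((_ , _) , pe) ((_ , _) , pf) eS fS e≢f (inj₁ (inj₂ refl)) =
    e≢f (inj₂ (refl , matchingS pe (adj-sym pf) eS (∈-flip S fS)))
  matching⇒separated {S} matchingS ((_ , _) , pe) ((_ , _) , pf) eS fS e≢f (inj₂ (inj₁ refl)) =
    e≢f (inj₂ (matchingS (adj-sym pe) pf (∈-flip S eS) fS , refl))
  matching⇒separated {S} matchingS ((_ , _) , pe) ((_ , _) , pf) eS fS e≢f (inj₂ (inj₂ refl)) =
    e≢f (inj₁ (matchingS (adj-sym pe) (adj-sym pf) (∈-flip S eS) (∈-flip S fS) , refl))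

  separated⇒matching : ∀ {S} → Separated S → IsMatching S
  separated⇒matching sep {z} {o} {o′} p p′ m m′ with o ≟ o′
  ... | yes o≡o′ = o≡o′
  ... | no o≢o′  = ⊥-elim (sep ((z , o) , p) ((z , o′) , p′) m m′ distinct (inj₁ (inj₁ refl)))
    where
    distinct : ¬ SameEdge {G = G} ((z , o) , p) ((z , o′) , p′)
    distinct (inj₁ (_ , o≡o′))   = o≢o′ o≡o′
    distinct (inj₂ (z≡o′ , o≡z)) = o≢o′ (trans o≡z z≡o′)

module Rounding {n : ℕ} (G : Graph n) (R : EdgeSet G) where

  open GraphProperties G

  covered : Fin n → Bool
  covered v = any (mem R v) (nbrs G v)

  near far : Fin n → Bool
  near v = not (covered v) ∧ any covered (nbrs G v)
  far  v = not (covered v ∨ any covered (nbrs G v))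

  proposes : Fin n → Fin n → Bool
  proposes u w = far u ∧ firstTrueAt (map near (nbrs G u)) (portOf G u w)

  accepts : Fin n → Fin n → Bool
  accepts w x = firstTrueAt (map (λ u → proposes u w) (nbrs G w)) (portOf G w x)

  Accepted : Fin n → Fin n → Bool
  Accepted u v = accepts u v ∨ accepts v u

  inS : Fin n → Fin n → Bool
  inS u v = mem R u v ∨ Accepted u v

  inS-sym : ∀ u v → inS u v ≡ inS v u
  inS-sym u v = cong₂ _∨_ (memSym R u v) (∨-comm (accepts u v) (accepts v u))

  R⇒covered : ∀ {u v} → adj G u v ≡ true → mem R u v ≡ true → covered u ≡ true
  R⇒covered uv = any-true⁺ (mem R _) (adj⇒∈nbrs uv)

  R-endOf-covered : ∀ {v f} → f ∈E R → EndOf v f → covered v ≡ true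
  R-endOf-covered {f = (_ , _) , p} fR (inj₁ refl) = R⇒covered p fR
  R-endOf-covered {f = (_ , _) , p} fR (inj₂ refl) = R⇒covered (adj-sym p) (∈-flip R fR)

  covered⇒R-edge : ∀ {z} → covered z ≡ true → ∃ λ x → adj G z x ≡ true × mem R z x ≡ true
  covered⇒R-edge c with any-true⁻ (mem R _) c
  ... | x , x∈ , r = x , ∈nbrs⇒adj x∈ , r

  near⇒uncovered : ∀ {v} → near v ≡ true → covered v ≡ false
  near⇒uncovered h = not-injective {y = false} (∧-conicalˡ _ _ h)

  far⇒uncovered : ∀ {v} → far v ≡ true → covered v ≡ false
  far⇒uncovered h = ∨-conicalˡ _ _ (not-injective {y = false} h)

  far⇒noCoveredNbr : ∀ {v} → far v ≡ true → any covered (nbrs G v) ≡ false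
  far⇒noCoveredNbr h = ∨-conicalʳ _ _ (not-injective {y = false} h)

  near-far-disjoint : ∀ {v} → near v ≡ true → far v ≡ true → ⊥
  near-far-disjoint nv fv = not-¬ (∧-conicalʳ _ _ nv) (far⇒noCoveredNbr fv)

  far⇒nbrUncovered : ∀ {z y} → far z ≡ true → adj G z y ≡ true → covered y ≡ false
  far⇒nbrUncovered {y = y} fz zy with covered y in cy
  ... | false = refl
  ... | true  = ⊥-elim (not-¬ (any-true⁺ covered (adj⇒∈nbrs zy) cy) (far⇒noCoveredNbr fz))

  Covered : Fin n → Set
  Covered v = covered v ≡ true

  reachesCovered₁-or-far : ∀ z → Reaches Covered 1 z ⊎ far z ≡ true
  reachesCovered₁-or-far z with covered z in cz | any covered (nbrs G z) in cn
  ... | true  | _     = inj₁ (done cz)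
  ... | false | true  with any-true⁻ covered cn
  ...   | y , y∈ , cy = inj₁ (hop (∈nbrs⇒adj y∈) (done cy))
  reachesCovered₁-or-far z | false | false = inj₂ refl

  far⇒nearNbr : ∀ {z} → far z ≡ true → Reaches Covered 2 z →
                ∃ λ y → adj G z y ≡ true × near y ≡ true
  far⇒nearNbr fz (done cz)          = ⊥-elim (not-¬ cz (far⇒uncovered fz))
  far⇒nearNbr fz (hop zy (done cy)) = ⊥-elim (not-¬ cy (far⇒nbrUncovered fz zy))
  far⇒nearNbr fz (hop zy (hop yx (done cx))) =
    _ , zy , cong₂ (λ c a → not c ∧ a) (far⇒nbrUncovered fz zy) (any-true⁺ covered (adj⇒∈nbrs yx) cx)

  accepts⇒proposes : ∀ {w x} → adj G w x ≡ true → accepts w x ≡ true → proposes x w ≡ true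
  accepts⇒proposes wx = firstTrueAt-map-holds _ (adj⇒∈nbrs wx)

  accepts⇒firstNear : ∀ {w x} → adj G w x ≡ true → accepts w x ≡ true →
                      firstTrueAt (map near (nbrs G x)) (portOf G x w) ≡ true
  accepts⇒firstNear wx h = ∧-conicalʳ _ _ (accepts⇒proposes wx h)

  accepted⇒far : ∀ {w x} → adj G w x ≡ true → accepts w x ≡ true → far x ≡ true
  accepted⇒far wx h = ∧-conicalˡ _ _ (accepts⇒proposes wx h)

  acceptor⇒near : ∀ {w x} → adj G w x ≡ true → accepts w x ≡ true → near w ≡ true
  acceptor⇒near wx h = firstTrueAt-map-holds near (adj⇒∈nbrs (adj-sym wx)) (accepts⇒firstNear wx h)

  accepted-unique : ∀ {w x x′} → adj G w x ≡ true → adj G w x′ ≡ true →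
                    accepts w x ≡ true → accepts w x′ ≡ true → x ≡ x′
  accepted-unique wx wx′ = firstTrueAt-map-unique _ (adj⇒∈nbrs wx) (adj⇒∈nbrs wx′)

  acceptor-unique : ∀ {w w′ x} → adj G w x ≡ true → adj G w′ x ≡ true →
                    accepts w x ≡ true → accepts w′ x ≡ true → w ≡ w′
  acceptor-unique wx w′x h h′ =
    firstTrueAt-map-unique near (adj⇒∈nbrs (adj-sym wx)) (adj⇒∈nbrs (adj-sym w′x))
      (accepts⇒firstNear wx h) (accepts⇒firstNear w′x h′)

  accepted⇒uncovered : ∀ {z o} → adj G z o ≡ true → Accepted z o ≡ true → covered z ≡ false
  accepted⇒uncovered {z} {o} zo h with ∨-true⁻ (accepts z o) h
  ... | inj₁ zAo = near⇒uncovered (acceptor⇒near zo zAo)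
  ... | inj₂ oAz = far⇒uncovered (accepted⇒far (adj-sym zo) oAz)

  accepted-matching : ∀ {z o o′} → adj G z o ≡ true → adj G z o′ ≡ true →
                      Accepted z o ≡ true → Accepted z o′ ≡ true → o ≡ o′
  accepted-matching {z} {o} {o′} zo zo′ h h′ with ∨-true⁻ (accepts z o) h | ∨-true⁻ (accepts z o′) h′
  ... | inj₁ zAo | inj₁ zAo′ = accepted-unique zo zo′ zAo zAo′
  ... | inj₁ zAo | inj₂ o′Az =
    ⊥-elim (near-far-disjoint (acceptor⇒near zo zAo) (accepted⇒far (adj-sym zo′) o′Az))
  ... | inj₂ oAz | inj₁ zAo′ =
    ⊥-elim (near-far-disjoint (acceptor⇒near zo′ zAo′) (accepted⇒far (adj-sym zo) oAz))
  ... | inj₂ oAz | inj₂ o′Az = acceptor-unique (adj-sym zo) (adj-sym zo′) oAz o′Az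

  inS-at-vertex : ∀ {z o o′} → adj G z o ≡ true → adj G z o′ ≡ true →
                  inS z o ≡ true → inS z o′ ≡ true →
                  o ≡ o′ ⊎ (mem R z o ≡ true × mem R z o′ ≡ true)
  inS-at-vertex {z} {o} {o′} zo zo′ h h′ with ∨-true⁻ (mem R z o) h | ∨-true⁻ (mem R z o′) h′
  ... | inj₁ r | inj₁ r′ = inj₂ (r , r′)
  ... | inj₁ r | inj₂ a′ = ⊥-elim (not-¬ (R⇒covered zo r) (accepted⇒uncovered zo′ a′))
  ... | inj₂ a | inj₁ r′ = ⊥-elim (not-¬ (R⇒covered zo′ r′) (accepted⇒uncovered zo a))
  ... | inj₂ a | inj₂ a′ = inj₁ (accepted-matching zo zo′ a a′)

  acceptance⇐nearNbr : ∀ {z y} → far z ≡ true → adj G z y ≡ true → near y ≡ true →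
                       ∃ λ w → adj G z w ≡ true × ∃ λ x → adj G w x ≡ true × accepts w x ≡ true
  acceptance⇐nearNbr {z} fz zy ny with firstTrueAt-exists near (nbrs G z) (adj⇒∈nbrs zy) ny
  ... | w , w∈ , firstNear
    with firstTrueAt-exists (λ u → proposes u w) (nbrs G w) (adj⇒∈nbrs (adj-sym (∈nbrs⇒adj w∈)))
           (cong₂ _∧_ fz firstNear)
  ... | x , x∈ , wAx = w , ∈nbrs⇒adj w∈ , x , ∈nbrs⇒adj x∈ , wAx

  module _ (S : EdgeSet G) (mem-S : ∀ {u v} → adj G u v ≡ true → mem S u v ≡ inS u v) where

    inS⇒∈S : ∀ {u v} (p : adj G u v ≡ true) → inS u v ≡ true → _∈E_ {G = G} ((u , v) , p) S
    inS⇒∈S p = trans (mem-S p)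

    R⊆S : R ⊆E S
    R⊆S ((u , v) , p) r = inS⇒∈S p (cong (_∨ Accepted u v) r)

    accepts⇒∈S : ∀ {w x} (p : adj G w x ≡ true) → accepts w x ≡ true → _∈E_ {G = G} ((w , x) , p) S
    accepts⇒∈S {w} {x} p h =
      inS⇒∈S p (trans (cong (λ b → mem R w x ∨ b ∨ accepts x w) h) (∨-zeroʳ (mem R w x)))

    S-matching : IsMatching R → IsMatching S
    S-matching matchingR zo zo′ m m′
      with inS-at-vertex zo zo′ (trans (sym (mem-S zo)) m) (trans (sym (mem-S zo′)) m′)
    ... | inj₁ o≡o′     = o≡o′
    ... | inj₂ (r , r′) = matchingR zo zo′ r r′

    S-close : Edge G → Set
    S-close e = ∃ λ f → f ∈E S × Dist≤ {G = G} 2 e f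

    S-close⇐reachesCovered₁ : ∀ {z e} → EndOf z e → Reaches Covered 1 z → S-close e
    S-close⇐reachesCovered₁ ze (done cz) with covered⇒R-edge cz
    ... | _ , p , r = _ , R⊆S (_ , p) r , dist≤2-incident ze p
    S-close⇐reachesCovered₁ ze (hop zy (done cy)) with covered⇒R-edge cy
    ... | _ , p , r = _ , R⊆S (_ , p) r , dist≤2-twoHops ze zy p

    S-close⇐far : ∀ {z e} → EndOf z e → far z ≡ true → Reaches Covered 2 z → S-close e
    S-close⇐far ze fz r with far⇒nearNbr fz r
    ... | _ , zy , ny with acceptance⇐nearNbr fz zy ny
    ... | _ , zw , _ , wx , wAx = _ , accepts⇒∈S wx wAx , dist≤2-twoHops ze zw wx

    S-dominates : (∀ e → ∃ λ f → f ∈E R × Dist≤ {G = G} 3 e f) → ∀ e → S-close e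
    S-dominates R-dominates e with R-dominates e
    ... | f , fR , d with dist⇒reaches (R-endOf-covered {f = f} fR) d
    ... | z , ze , r with reachesCovered₁-or-far z
    ... | inj₁ r₁ = S-close⇐reachesCovered₁ ze r₁
    ... | inj₂ fz = S-close⇐far ze fz r

    ruling₃⇒ruling₂ : IsRuling G 3 R → IsRuling G 2 S × R ⊆E S
    ruling₃⇒ruling₂ (separatedR , R-dominates) =
      ( matching⇒separated {S} (S-matching (separated⇒matching {R} separatedR))
      , S-dominates R-dominates )
      , R⊆S

encodeBit : ∀ {n} → Bool → Fin (suc n ^ 1)
encodeBit {zero}  _     = Fin.zero
encodeBit {suc _} false = Fin.zero
encodeBit {suc _} true  = Fin.suc Fin.zero

decodeBit : ∀ {n} → Fin (suc n ^ 1) → Bool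
decodeBit Fin.zero    = false
decodeBit (Fin.suc _) = true

-- For n = 0 the message space has a single element, but then there are no nodes.
decode-encode : ∀ {n} → Fin n → ∀ b → decodeBit {n} (encodeBit {n} b) ≡ b
decode-encode {suc _} _ false = refl
decode-encode {suc _} _ true  = refl

decode-broadcast : ∀ {n} (f : Fin n → Bool) xs →
                   map (decodeBit {n}) (map (λ u → encodeBit {n} (f u)) xs) ≡ map f xs
decode-broadcast f []       = refl
decode-broadcast f (x ∷ xs) = cong₂ _∷_ (decode-encode x (f x)) (decode-broadcast f xs)

-- Every list is indexed by port.
record NodeState : Set where
  field
    round       : ℕ
    inR         : List Bool
    coveredNbrs : List Bool
    nearNbrs    : List Bool
    proposals   : List Bool
    acceptances : List Bool
open NodeState

isCovered isNear isFar : NodeState → Bool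
isCovered s = or (inR s)
isNear    s = not (isCovered s) ∧ or (coveredNbrs s)
isFar     s = not (isCovered s ∨ or (coveredNbrs s))

message : ℕ → NodeState → ℕ → Bool
message 0 s _ = isCovered s
message 1 s _ = isNear s
message 2 s p = isFar s ∧ firstTrueAt (nearNbrs s) p
message 3 s p = firstTrueAt (proposals s) p
message _ _ _ = false

deliver : ℕ → NodeState → List Bool → NodeState
deliver 0 s bs = record s { round = 1 ; coveredNbrs = bs }
deliver 1 s bs = record s { round = 2 ; nearNbrs = bs }
deliver 2 s bs = record s { round = 3 ; proposals = bs }
deliver 3 s bs = record s { round = 4 ; acceptances = bs }
deliver _ s _  = s

initialState : List Bool → NodeState
initialState bs = record
  { round = 0 ; inR = bs ; coveredNbrs = [] ; nearNbrs = [] ; proposals = [] ; acceptances = [] }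

rulingUpgrade : Algorithm
rulingUpgrade = record
  { B     = 1
  ; State = λ _ → NodeState
  ; init  = λ _ _ → initialState
  ; send  = λ {n} s p → encodeBit {n} (message (round s) s p)
  ; recv  = λ {n} s ms → deliver (round s) s (map (decodeBit {n}) ms)
  ; out   = λ s p → bitAt (inR s) p ∨ firstTrueAt (proposals s) p ∨ bitAt (acceptances s) p
  }

module Execution {n : ℕ} (G : Graph n) (ID : Fin n → ℕ) (R : EdgeSet G) where

  open GraphProperties G
  open Rounding G R

  state : ℕ → Fin n → NodeState
  state = stateAt rulingUpgrade G ID R

  coveredNbrs-state : ∀ v → coveredNbrs (state 1 v) ≡ map covered (nbrs G v)
  coveredNbrs-state v = decode-broadcast covered (nbrs G v)

  isNear-state : ∀ v → isNear (state 1 v) ≡ near v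
  isNear-state v = cong (λ bs → not (covered v) ∧ or bs) (coveredNbrs-state v)

  isFar-state : ∀ v → isFar (state 2 v) ≡ far v
  isFar-state v = cong (λ bs → not (covered v ∨ or bs)) (coveredNbrs-state v)

  nearNbrs-state : ∀ v → nearNbrs (state 2 v) ≡ map near (nbrs G v)
  nearNbrs-state v =
    trans (decode-broadcast (λ u → isNear (state 1 u)) (nbrs G v)) (map-cong isNear-state (nbrs G v))

  proposals-state : ∀ v → proposals (state 3 v) ≡ map (λ u → proposes u v) (nbrs G v)
  proposals-state v =
    trans (decode-broadcast (λ u → message 2 (state 2 u) (portOf G u v)) (nbrs G v))
          (map-cong proposal (nbrs G v))
    where
    proposal : ∀ u → message 2 (state 2 u) (portOf G u v) ≡ proposes u v
    proposal u = cong₂ (λ b bs → b ∧ firstTrueAt bs (portOf G u v)) (isFar-state u) (nearNbrs-state u)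

  acceptances-state : ∀ v → acceptances (state 4 v) ≡ map (λ u → accepts u v) (nbrs G v)
  acceptances-state v =
    trans (decode-broadcast (λ u → message 3 (state 3 u) (portOf G u v)) (nbrs G v))
          (map-cong acceptance (nbrs G v))
    where
    acceptance : ∀ u → message 3 (state 3 u) (portOf G u v) ≡ accepts u v
    acceptance u = cong (λ bs → firstTrueAt bs (portOf G u v)) (proposals-state u)

  outBit-inS : ∀ {u v} → adj G u v ≡ true → outBit rulingUpgrade G ID R 4 u v ≡ inS u v
  outBit-inS {u} {v} uv = cong₂ _∨_ inR-bit (cong₂ _∨_ proposal-bit acceptance-bit)
    where
    port = portOf G u v
    inR-bit : bitAt (inR (state 4 u)) port ≡ mem R u v
    inR-bit = bitAt-map-indexOf (mem R u) (nbrs G u) (adj⇒∈nbrs uv)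
    proposal-bit : firstTrueAt (proposals (state 4 u)) port ≡ accepts u v
    proposal-bit = cong (λ bs → firstTrueAt bs port) (proposals-state u)
    acceptance-bit : bitAt (acceptances (state 4 u)) port ≡ accepts v u
    acceptance-bit = trans (cong (λ bs → bitAt bs port) (acceptances-state u))
                           (bitAt-map-indexOf (λ x → accepts x u) (nbrs G u) (adj⇒∈nbrs uv))

  consistent : Consistent rulingUpgrade G ID R 4
  consistent u v uv = begin
    outBit rulingUpgrade G ID R 4 u v ≡⟨ outBit-inS uv ⟩
    inS u v                           ≡⟨ inS-sym u v ⟩
    inS v u                           ≡⟨ outBit-inS (adj-sym uv) ⟨
    outBit rulingUpgrade G ID R 4 v u ∎
    where open ≡-Reasoning

  output : EdgeSet G
  output = outputSet rulingUpgrade G ID R 4 consistent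

  mem-output : ∀ {u v} → adj G u v ≡ true → mem output u v ≡ inS u v
  mem-output uv = cong₂ _∧_ uv (outBit-inS uv)

-- Choices are made by port order.
lemma14 : (c : ℕ) → Σ Algorithm λ A → Σ ℕ λ T →
    ∀ (n : ℕ) (G : Graph n) (ID : Fin n → ℕ) (R : EdgeSet G) →
    ValidIDs c n ID → IsRuling G 3 R →
    Σ (Consistent A G ID R T) λ cons →
      IsRuling G 2 (outputSet A G ID R T cons) × (R ⊆E outputSet A G ID R T cons)
lemma14 _ = rulingUpgrade , 4 , λ n G ID R _ ruling →
  let open Execution G ID R in
  consistent , Rounding.ruling₃⇒ruling₂ G R output mem-output ruling
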